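{- For every $\Sigma_0$-formula $\varphi$, \[ \mathsf{IKP}\vdash \big(\forall \alpha\in\mathrm{Ord}\;(0\in\alpha+1)\big)\longrightarrow (\varphi\vee\neg\varphi), \] i.e. the statement that $0\in\alpha+1$ for every ordinal $\alpha$ implies the Law of Excluded Middle for $\Sigma_0$-formulae.
   Context: $\mathsf{IKP}$ is the theory with intuitionistic logic whose axioms are Extensionality, Empty Set, Pairing, Unions, Strong Infinity, Set Induction scheme, $\Sigma_0$-Separation scheme and $\Sigma_0$-Collection scheme. An ordinal is a transitive set all of whose elements are transitive sets. $0=\emptyset$ and $\alpha+1=\alpha\cup\{\alpha\}$. -}

module Defs where

open import Data.Nat using (ℕ; zero; suc; _+_)
open import Data.List using (List; []; _∷_; map)
open import Data.List.Membership.Propositional using (_∈_)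

-- Syntax of first-order set theory (language {∈, =}), de Bruijn indices.
-- Terms are just variables; variable n is written  v n.

data Fm : Set where
  _∈̇_  : ℕ → ℕ → Fm
  _≐_  : ℕ → ℕ → Fm
  ⊥̇    : Fm
  _∧̇_  : Fm → Fm → Fm
  _∨̇_  : Fm → Fm → Fm
  _⇒̇_  : Fm → Fm → Fm
  ∀̇    : Fm → Fm
  ∃̇    : Fm → Fm

infixr 6 _∧̇_
infixr 5 _∨̇_
infixr 4 _⇒̇_ _⇔̇_
infix 7 _∈̇_ _≐_

¬̇_ : Fm → Fm
¬̇ A = A ⇒̇ ⊥̇

_⇔̇_ : Fm → Fm → Fm
A ⇔̇ B = (A ⇒̇ B) ∧̇ (B ⇒̇ A)

-- Renaming (= substitution, since terms are variables)
Ren : Set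
Ren = ℕ → ℕ

lift : Ren → Ren
lift ρ zero    = zero
lift ρ (suc n) = suc (ρ n)

ren : Ren → Fm → Fm
ren ρ (x ∈̇ y) = ρ x ∈̇ ρ y
ren ρ (x ≐ y) = ρ x ≐ ρ y
ren ρ ⊥̇       = ⊥̇
ren ρ (A ∧̇ B) = ren ρ A ∧̇ ren ρ B
ren ρ (A ∨̇ B) = ren ρ A ∨̇ ren ρ B
ren ρ (A ⇒̇ B) = ren ρ A ⇒̇ ren ρ B
ren ρ (∀̇ A)   = ∀̇ (ren (lift ρ) A)
ren ρ (∃̇ A)   = ∃̇ (ren (lift ρ) A)

shift : Fm → Fm
shift = ren suc

inst : ℕ → Ren
inst x zero    = x
inst x (suc n) = n

_[_] : Fm → ℕ → Fm
A [ x ] = ren (inst x) A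

∀∈ : ℕ → Fm → Fm
∀∈ y A = ∀̇ (0 ∈̇ suc y ⇒̇ A)

∃∈ : ℕ → Fm → Fm
∃∈ y A = ∃̇ (0 ∈̇ suc y ∧̇ A)

data Σ₀ : Fm → Set where
  s-∈  : ∀ x y → Σ₀ (x ∈̇ y)
  s-≐  : ∀ x y → Σ₀ (x ≐ y)
  s-⊥  : Σ₀ ⊥̇
  s-∧  : ∀ {A B} → Σ₀ A → Σ₀ B → Σ₀ (A ∧̇ B)
  s-∨  : ∀ {A B} → Σ₀ A → Σ₀ B → Σ₀ (A ∨̇ B)
  s-⇒  : ∀ {A B} → Σ₀ A → Σ₀ B → Σ₀ (A ⇒̇ B)
  s-∀∈ : ∀ {A} y → Σ₀ A → Σ₀ (∀∈ y A)
  s-∃∈ : ∀ {A} y → Σ₀ A → Σ₀ (∃∈ y A)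

Empty : ℕ → Fm
Empty x = ∀̇ (¬̇ (0 ∈̇ suc x))

IsSucc : ℕ → ℕ → Fm
IsSucc w y = ∀̇ (0 ∈̇ suc w ⇔̇ (0 ∈̇ suc y ∨̇ 0 ≐ suc y))

Ind : ℕ → Fm
Ind a = ∃∈ a (Empty 0) ∧̇ ∀∈ a (∃∈ (suc a) (IsSucc 0 1))

Trans : ℕ → Fm
Trans x = ∀∈ x (∀∈ 0 (0 ∈̇ suc (suc x)))

Ord : ℕ → Fm
Ord x = Trans x ∧̇ ∀∈ x (Trans 0)

-- ZeroInSucc(α) : 0 ∈ α+1, i.e. ∃z (Empty z ∧ ∃s (s = α ∪ {α} ∧ z ∈ s))
ZeroInSucc : ℕ → Fm
ZeroInSucc a = ∃̇ (Empty 0 ∧̇ ∃̇ (IsSucc 0 (suc (suc a)) ∧̇ 1 ∈̇ 0))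

AllOrdZeroInSucc : Fm
AllOrdZeroInSucc = ∀̇ (Ord 0 ⇒̇ ZeroInSucc 0)

-- Scheme formulas φ have their first m variables bound by the scheme and
-- variable m+n denoting parameter n (the n-th free variable of the axiom).
keep : ℕ → Ren → Ren
keep zero    ρ = ρ
keep (suc m) ρ = lift (keep m ρ)

data IKPAx : Fm → Set where
  extensionality : IKPAx (∀̇ (∀̇ (∀̇ (0 ∈̇ 2 ⇔̇ 0 ∈̇ 1) ⇒̇ 1 ≐ 0)))
  emptySet       : IKPAx (∃̇ (Empty 0))
  pairing        : IKPAx (∀̇ (∀̇ (∃̇ (2 ∈̇ 0 ∧̇ 1 ∈̇ 0))))
  union          : IKPAx (∀̇ (∃̇ (∀∈ 1 (∀∈ 0 (0 ∈̇ 2)))))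
  strongInfinity : IKPAx (∃̇ (Ind 0 ∧̇ ∀̇ (Ind 0 ⇒̇ ∀∈ 1 (0 ∈̇ 1))))
  -- φ: variable 0 = a, others parameters
  setInduction   : (φ : Fm) →
    IKPAx (∀̇ (∀∈ 0 (ren (keep 1 (1 +_)) φ) ⇒̇ φ) ⇒̇ ∀̇ φ)
  -- φ: variable 0 = c, others parameters (b not free in φ)
  Σ₀-separation  : (φ : Fm) → Σ₀ φ →
    IKPAx (∀̇ (∃̇ (∀̇ (0 ∈̇ 1 ⇔̇ (0 ∈̇ 2 ∧̇ ren (keep 1 (2 +_)) φ)))))
  -- φ: variable 0 = c, variable 1 = b, others parameters (d not free in φ)
  Σ₀-collection  : (φ : Fm) → Σ₀ φ →
    IKPAx (∀̇ (∀∈ 0 (∃̇ (ren (keep 2 (1 +_)) φ))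
              ⇒̇ ∃̇ (∀∈ 1 (∃∈ 1 (ren (keep 2 (2 +_)) φ)))))

Ctx : Set
Ctx = List Fm

infix 2 _⊢_
data _⊢_ : Ctx → Fm → Set where
  hyp   : ∀ {Γ A} → A ∈ Γ → Γ ⊢ A
  axiom : ∀ {Γ A} → IKPAx A → Γ ⊢ A
  ⊥E    : ∀ {Γ A} → Γ ⊢ ⊥̇ → Γ ⊢ A
  ∧I    : ∀ {Γ A B} → Γ ⊢ A → Γ ⊢ B → Γ ⊢ A ∧̇ B
  ∧E₁   : ∀ {Γ A B} → Γ ⊢ A ∧̇ B → Γ ⊢ A
  ∧E₂   : ∀ {Γ A B} → Γ ⊢ A ∧̇ B → Γ ⊢ B
  ∨I₁   : ∀ {Γ A B} → Γ ⊢ A → Γ ⊢ A ∨̇ B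
  ∨I₂   : ∀ {Γ A B} → Γ ⊢ B → Γ ⊢ A ∨̇ B
  ∨E    : ∀ {Γ A B C} → Γ ⊢ A ∨̇ B → A ∷ Γ ⊢ C → B ∷ Γ ⊢ C → Γ ⊢ C
  ⇒I    : ∀ {Γ A B} → A ∷ Γ ⊢ B → Γ ⊢ A ⇒̇ B
  ⇒E    : ∀ {Γ A B} → Γ ⊢ A ⇒̇ B → Γ ⊢ A → Γ ⊢ B
  ∀I    : ∀ {Γ A} → map shift Γ ⊢ A → Γ ⊢ ∀̇ A
  ∀E    : ∀ {Γ A} → Γ ⊢ ∀̇ A → (x : ℕ) → Γ ⊢ A [ x ]
  ∃I    : ∀ {Γ A} (x : ℕ) → Γ ⊢ A [ x ] → Γ ⊢ ∃̇ A
  ∃E    : ∀ {Γ A B} → Γ ⊢ ∃̇ A → A ∷ map shift Γ ⊢ shift B → Γ ⊢ B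
  ≐refl : ∀ {Γ} (x : ℕ) → Γ ⊢ x ≐ x
  ≐subst : ∀ {Γ A x y} → Γ ⊢ x ≐ y → Γ ⊢ A [ x ] → Γ ⊢ A [ y ]

IKP⊢_ : Fm → Set
IKP⊢ A = [] ⊢ A

{-# OPTIONS --safe #-}
-- Separate the Σ₀ formula φ from a set a containing the empty set e:
-- α := {x ∈ a | x = ∅ ∧ φ}. All elements of α are empty, so α is an ordinal,
-- and the hypothesis yields an empty set z ∈ α + 1, i.e. z ∈ α or z = α.
-- If z ∈ α then φ holds. If z = α then α is empty, so e ∉ α, and as e ∈ a
-- with e = ∅ this refutes φ.
module Submission where

open import Defs
open import Data.Nat using (ℕ; zero; suc; _+_)
open import Data.Fin using (Fin; #_)
open import Data.List using (_∷_; map; length; lookup)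
open import Data.List.Relation.Binary.Subset.Propositional using (_⊆_)
open import Data.List.Relation.Binary.Subset.Propositional.Properties
  using (map⁺; ∷⁺ʳ; xs⊆x∷xs)
open import Data.List.Membership.Propositional.Properties using (∈-lookup)
open import Function using (id; _∘_)
open import Relation.Binary.PropositionalEquality
  using (_≡_; refl; sym; trans; cong; cong₂; subst; _≗_)

private
  variable
    Γ Δ : Ctx
    A B C : Fm
    x y z e a α : ℕ
    ρ σ : Ren

lift-≗ : ρ ≗ σ → lift ρ ≗ lift σ
lift-≗ p zero    = refl
lift-≗ p (suc n) = cong suc (p n)

ren-≗ : ρ ≗ σ → ∀ A → ren ρ A ≡ ren σ A
ren-≗ p (x ∈̇ y) = cong₂ _∈̇_ (p x) (p y)
ren-≗ p (x ≐ y) = cong₂ _≐_ (p x) (p y)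
ren-≗ p ⊥̇       = refl
ren-≗ p (A ∧̇ B) = cong₂ _∧̇_ (ren-≗ p A) (ren-≗ p B)
ren-≗ p (A ∨̇ B) = cong₂ _∨̇_ (ren-≗ p A) (ren-≗ p B)
ren-≗ p (A ⇒̇ B) = cong₂ _⇒̇_ (ren-≗ p A) (ren-≗ p B)
ren-≗ p (∀̇ A)   = cong ∀̇ (ren-≗ (lift-≗ p) A)
ren-≗ p (∃̇ A)   = cong ∃̇ (ren-≗ (lift-≗ p) A)

lift-∘ : ∀ ρ σ → lift ρ ∘ lift σ ≗ lift (ρ ∘ σ)
lift-∘ ρ σ zero    = refl
lift-∘ ρ σ (suc n) = refl

ren-ren : ∀ ρ σ A → ren ρ (ren σ A) ≡ ren (ρ ∘ σ) A
ren-ren ρ σ (x ∈̇ y) = refl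
ren-ren ρ σ (x ≐ y) = refl
ren-ren ρ σ ⊥̇       = refl
ren-ren ρ σ (A ∧̇ B) = cong₂ _∧̇_ (ren-ren ρ σ A) (ren-ren ρ σ B)
ren-ren ρ σ (A ∨̇ B) = cong₂ _∨̇_ (ren-ren ρ σ A) (ren-ren ρ σ B)
ren-ren ρ σ (A ⇒̇ B) = cong₂ _⇒̇_ (ren-ren ρ σ A) (ren-ren ρ σ B)
ren-ren ρ σ (∀̇ A)   =
  cong ∀̇ (trans (ren-ren (lift ρ) (lift σ) A) (ren-≗ (lift-∘ ρ σ) A))
ren-ren ρ σ (∃̇ A)   =
  cong ∃̇ (trans (ren-ren (lift ρ) (lift σ) A) (ren-≗ (lift-∘ ρ σ) A))

lift-id : lift id ≗ id
lift-id zero    = refl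
lift-id (suc n) = refl

ren-id : ∀ A → ren id A ≡ A
ren-id (x ∈̇ y) = refl
ren-id (x ≐ y) = refl
ren-id ⊥̇       = refl
ren-id (A ∧̇ B) = cong₂ _∧̇_ (ren-id A) (ren-id B)
ren-id (A ∨̇ B) = cong₂ _∨̇_ (ren-id A) (ren-id B)
ren-id (A ⇒̇ B) = cong₂ _⇒̇_ (ren-id A) (ren-id B)
ren-id (∀̇ A)   = cong ∀̇ (trans (ren-≗ lift-id A) (ren-id A))
ren-id (∃̇ A)   = cong ∃̇ (trans (ren-≗ lift-id A) (ren-id A))

ren-lift-shift : ∀ ρ A → ren (lift ρ) (shift A) ≡ shift (ren ρ A)
ren-lift-shift ρ A = trans (ren-ren (lift ρ) suc A) (sym (ren-ren suc ρ A))

shift-inst : ∀ x A → shift A [ x ] ≡ A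
shift-inst x A = trans (ren-ren (inst x) suc A) (ren-id A)

ren-Σ₀ : ∀ ρ → Σ₀ A → Σ₀ (ren ρ A)
ren-Σ₀ ρ (s-∈ x y)  = s-∈ (ρ x) (ρ y)
ren-Σ₀ ρ (s-≐ x y)  = s-≐ (ρ x) (ρ y)
ren-Σ₀ ρ s-⊥        = s-⊥
ren-Σ₀ ρ (s-∧ p q)  = s-∧ (ren-Σ₀ ρ p) (ren-Σ₀ ρ q)
ren-Σ₀ ρ (s-∨ p q)  = s-∨ (ren-Σ₀ ρ p) (ren-Σ₀ ρ q)
ren-Σ₀ ρ (s-⇒ p q)  = s-⇒ (ren-Σ₀ ρ p) (ren-Σ₀ ρ q)
ren-Σ₀ ρ (s-∀∈ y p) = s-∀∈ (ρ y) (ren-Σ₀ (lift ρ) p)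
ren-Σ₀ ρ (s-∃∈ y p) = s-∃∈ (ρ y) (ren-Σ₀ (lift ρ) p)

hyp# : (i : Fin (length Γ)) → Γ ⊢ lookup Γ i
hyp# i = hyp (∈-lookup i)

weaken : Γ ⊆ Δ → Γ ⊢ A → Δ ⊢ A
weaken s (hyp m)        = hyp (s m)
weaken s (axiom ax)     = axiom ax
weaken s (⊥E d)         = ⊥E (weaken s d)
weaken s (∧I d d′)      = ∧I (weaken s d) (weaken s d′)
weaken s (∧E₁ d)        = ∧E₁ (weaken s d)
weaken s (∧E₂ d)        = ∧E₂ (weaken s d)
weaken s (∨I₁ d)        = ∨I₁ (weaken s d)
weaken s (∨I₂ d)        = ∨I₂ (weaken s d)
weaken s (∨E d d₁ d₂)   = ∨E (weaken s d) (weaken (∷⁺ʳ _ s) d₁) (weaken (∷⁺ʳ _ s) d₂)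
weaken s (⇒I d)         = ⇒I (weaken (∷⁺ʳ _ s) d)
weaken s (⇒E d d′)      = ⇒E (weaken s d) (weaken s d′)
weaken s (∀I d)         = ∀I (weaken (map⁺ shift s) d)
weaken s (∀E d x)       = ∀E (weaken s d) x
weaken s (∃I x d)       = ∃I x (weaken s d)
weaken s (∃E d d′)      = ∃E (weaken s d) (weaken (∷⁺ʳ _ (map⁺ shift s)) d′)
weaken s (≐refl x)      = ≐refl x
weaken s (≐subst d d′)  = ≐subst (weaken s d) (weaken s d′)

wk : Γ ⊢ A → B ∷ Γ ⊢ A
wk = weaken (xs⊆x∷xs _ _)

cast : A ≡ B → Γ ⊢ A → Γ ⊢ B
cast = subst (_ ⊢_)

IsSep : ℕ → ℕ → Fm → Fm
IsSep s a C = ∀̇ (0 ∈̇ suc s ⇔̇ (0 ∈̇ suc a ∧̇ C))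

∀∈E : Γ ⊢ ∀∈ x A → Γ ⊢ y ∈̇ x → Γ ⊢ A [ y ]
∀∈E d m = ⇒E (∀E d _) m

∀∈I-with : Γ ⊢ A → (0 ∈̇ suc x) ∷ shift A ∷ map shift Γ ⊢ B → Γ ⊢ ∀∈ x B
∀∈I-with d e = ⇒E (⇒I (∀I (⇒I e))) d

Empty-∉ : Γ ⊢ Empty x → Γ ⊢ y ∈̇ x → Γ ⊢ C
Empty-∉ d m = ⊥E (⇒E (∀E d _) m)

Empty⇒∀∈ : Γ ⊢ Empty x → Γ ⊢ ∀∈ x A
Empty⇒∀∈ d = ∀∈I-with d (Empty-∉ (hyp# (# 1)) (hyp# (# 0)))

Ord-of-empties : Γ ⊢ ∀∈ α (Empty 0) → Γ ⊢ Ord α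
Ord-of-empties {α = α} d =
  ∧I (∀∈I-with d (Empty⇒∀∈ element-empty)) (∀∈I-with d (Empty⇒∀∈ element-empty))
  where
  element-empty : (0 ∈̇ suc α) ∷ shift (∀∈ α (Empty 0)) ∷ Δ ⊢ Empty 0
  element-empty = ∀∈E (hyp# (# 1)) (hyp# (# 0))

≐-sym : Γ ⊢ x ≐ y → Γ ⊢ y ≐ x
≐-sym {x = x} d = ≐subst {A = 0 ≐ suc x} d (≐refl x)

∈-substʳ : Γ ⊢ x ≐ y → Γ ⊢ z ∈̇ x → Γ ⊢ z ∈̇ y
∈-substʳ {z = z} d = ≐subst {A = suc z ∈̇ 0} d

IsSucc-∈ : Γ ⊢ IsSucc y x → Γ ⊢ z ∈̇ y → Γ ⊢ z ∈̇ x ∨̇ z ≐ x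
IsSucc-∈ d m = ⇒E (∧E₁ (∀E d _)) m

ZeroInSucc-elim : Γ ⊢ ZeroInSucc α → Γ ⊢ ∃̇ (Empty 0 ∧̇ (0 ∈̇ suc α ∨̇ 0 ≐ suc α))
ZeroInSucc-elim d =
  ∃E d (∃E (∧E₂ (hyp# (# 0)))
    (∃I 1 (∧I (∧E₁ (hyp# (# 1))) (IsSucc-∈ (∧E₁ (hyp# (# 0))) (∧E₂ (hyp# (# 0)))))))

IsSep-elim : Γ ⊢ IsSep y a C → Γ ⊢ x ∈̇ y → Γ ⊢ C [ x ]
IsSep-elim d m = ∧E₂ (⇒E (∧E₁ (∀E d _)) m)

IsSep-intro : Γ ⊢ IsSep y a C → Γ ⊢ x ∈̇ a → Γ ⊢ C [ x ] → Γ ⊢ x ∈̇ y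
IsSep-intro d m c = ⇒E (∧E₂ (∀E d _)) (∧I m c)

IsSep-Empty : Γ ⊢ IsSep α a (Empty 0 ∧̇ C) → Γ ⊢ ∀∈ α (Empty 0)
IsSep-Empty d = ∀∈I-with d (∧E₁ (IsSep-elim (hyp# (# 1)) (hyp# (# 0))))

Σ₀-separation-Empty : ∀ a → Σ₀ B → Γ ⊢ ∃̇ (IsSep 0 (suc a) (Empty 0 ∧̇ shift (shift B)))
Σ₀-separation-Empty {B = B} a σB =
  cast (cong (λ C → ∃̇ (IsSep 0 (suc a) (Empty 0 ∧̇ C))) parameters)
       (∀E (axiom (Σ₀-separation (Empty 0 ∧̇ shift B) (s-∧ (s-∀∈ 0 s-⊥) (ren-Σ₀ suc σB)))) a)
  where
  parameters : ren (lift (lift (inst a))) (ren (lift (2 +_)) (shift B)) ≡ shift (shift B)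
  parameters = trans (ren-ren _ _ (shift B)) (trans (ren-ren _ suc B) (sym (ren-ren suc suc B)))

IsSep-decides : Γ ⊢ IsSep α a (Empty 0 ∧̇ shift B) → Γ ⊢ Empty e → Γ ⊢ e ∈̇ a →
                Γ ⊢ Empty z → Γ ⊢ z ∈̇ α ∨̇ z ≐ α → Γ ⊢ B ∨̇ ¬̇ B
IsSep-decides {Γ = Γ} {α = α} {B = B} {e = e} {z = z} sep e-empty e∈a z-empty z∈α∨z≐α =
  ∨E z∈α∨z≐α (∨I₁ B-holds) (∨I₂ (⇒I B-fails))
  where
  B-holds : (z ∈̇ α) ∷ Γ ⊢ B
  B-holds = cast (shift-inst z B) (∧E₂ (IsSep-elim (wk sep) (hyp# (# 0))))

  e∈α : B ∷ (z ≐ α) ∷ Γ ⊢ e ∈̇ α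
  e∈α = IsSep-intro (wk (wk sep)) (wk (wk e∈a))
          (∧I (wk (wk e-empty)) (cast (sym (shift-inst e B)) (hyp# (# 0))))

  B-fails : B ∷ (z ≐ α) ∷ Γ ⊢ ⊥̇
  B-fails = Empty-∉ (wk (wk z-empty)) (∈-substʳ (≐-sym (hyp# (# 1))) e∈α)

mainTheorem4 : (φ : Fm) → Σ₀ φ → IKP⊢ (AllOrdZeroInSucc ⇒̇ (φ ∨̇ ¬̇ φ))
mainTheorem4 φ σφ =
  -- Variables introduced, innermost first: z, α, a, e.
  ⇒I (∃E (axiom emptySet)
     (∃E (∀E (∀E (axiom pairing) 0) 0)
     (∃E (Σ₀-separation-Empty 0 (ren-Σ₀ suc (ren-Σ₀ suc σφ)))
     (∃E (ZeroInSucc-elim (⇒E (∀E (hyp# (# 3)) 0) (Ord-of-empties (IsSep-Empty (hyp# (# 0))))))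
     (IsSep-decides (cast shifted-sep (hyp# (# 1))) (hyp# (# 3)) (∧E₁ (hyp# (# 2)))
                    (∧E₁ (hyp# (# 0))) (∧E₂ (hyp# (# 0))))))))
  where
  shifted-sep : shift (IsSep 0 1 (Empty 0 ∧̇ shift (shift (shift (shift φ)))))
              ≡ IsSep 1 2 (Empty 0 ∧̇ shift (shift (shift (shift (shift φ)))))
  shifted-sep = cong (λ C → IsSep 1 2 (Empty 0 ∧̇ C)) (ren-lift-shift suc (shift (shift (shift φ))))
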